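{- Let $n\ge1$ and $d\ge2$ be integers with $d$-sequence $n=n_0,n_1,\dots,n_k=n_{k+1}$, and let $\delta=d_0\cdots d_{k-1}$, $m=n_k$, so that $n=\delta m$ with $\gcd(\delta,m)=1$. Then $\Sigma(n,d)\cong\Sigma_0(n,d)\oplus\Sigma(m,d)$ and $S(n,d)\cong S_0(n,d)\oplus S(m,d)$, where $\Sigma_0(n,d)$ and $S_0(n,d)$ are the kernels of multiplication by $d^k$ on $\Sigma(n,d)$ and $S(n,d)$ respectively.
   Context: The $d$-sequence of $n$: $n_0=n$, $d_i=\gcd(n_i,d)$, $n_{i+1}=n_i/d_i$, with $k\ge0$ the smallest index with $d_k=1$. For $N\ge1$: in $\mathbb{Q}[x]/(x^N-1)$ (exponents mod $N$) put $e_v=x^v-1$, $\epsilon_v=d\,e_v-e_{dv}$; $\mathcal Z_N$ = $\mathbb{Z}$-span of $e_1,\dots,e_{N-1}$, $\mathcal E_{N,d}$ = $\mathbb{Z}$-span of $\epsilon_1,\dots,\epsilon_{N-1}$, $\Sigma(N,d)=\mathcal Z_N/\mathcal E_{N,d}$; with $f_v=dx^v-\sum_{i=0}^{d-1}x^{dv+i}$, $S(N,d)=\mathcal Z_N/\langle f_1,\dots,f_{N-1}\rangle_{\mathbb{Z}}$ (sandpile group of $\mathrm{DB}(N,d)$). -}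

module Defs where

open import Data.Nat as ℕ using (ℕ; zero; suc; _∸_; _%_; _/_)
open import Data.Nat.GCD using (gcd)
open import Data.Integer as ℤ using (ℤ; +_)
open import Data.Fin using (Fin; toℕ)
open import Data.Product using (Σ; ∃; _×_; _,_)
open import Data.Unit using (⊤)
open import Relation.Binary.PropositionalEquality using (_≡_)
open import Relation.Nullary using (yes; no)

-- division; the divisor is never 0 in our use (d ≥ 2 ⇒ gcd(n_i,d) ≥ 1)
div′ : ℕ → ℕ → ℕ
div′ a zero    = a
div′ a (suc b) = a / suc b

mutual
  nSeq : (n d i : ℕ) → ℕ
  nSeq n d zero    = n
  nSeq n d (suc i) = div′ (nSeq n d i) (dSeq n d i)

  dSeq : (n d i : ℕ) → ℕ
  dSeq n d i = gcd (nSeq n d i) d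

dProd : (n d k : ℕ) → ℕ
dProd n d zero    = 1
dProd n d (suc k) = dProd n d k ℕ.* dSeq n d k

-- ℚ[x]/(x^N - 1) restricted to integer coefficients (everything we need
-- lives in ℤ[x]/(x^N-1) ⊂ ℚ[x]/(x^N-1)): coefficient vectors indexed by
-- exponents 0..N-1.

Poly : ℕ → Set
Poly N = Fin N → ℤ

red : ℕ → ℕ → ℕ
red zero    v = v
red (suc N) v = v % suc N

X^ : (N v : ℕ) → Poly N
X^ N v i with toℕ i ℕ.≟ red N v
... | yes _ = + 1
... | no  _ = + 0

0P : (N : ℕ) → Poly N
0P N i = + 0

_+P_ : ∀ {N} → Poly N → Poly N → Poly N
(p +P q) i = p i ℤ.+ q i

_-P_ : ∀ {N} → Poly N → Poly N → Poly N
(p -P q) i = p i ℤ.- q i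

_·P_ : ∀ {N} → ℤ → Poly N → Poly N
(a ·P p) i = a ℤ.* p i

e : (N v : ℕ) → Poly N
e N v = X^ N v -P X^ N 0

ε : (N d v : ℕ) → Poly N
ε N d v = ((+ d) ·P e N v) -P e N (d ℕ.* v)

geo : (N a j : ℕ) → Poly N
geo N a zero    = 0P N
geo N a (suc j) = geo N a j +P X^ N (a ℕ.+ j)

f : (N d v : ℕ) → Poly N
f N d v = ((+ d) ·P X^ N v) -P geo N (d ℕ.* v) d

comb : (N : ℕ) → (ℕ → Poly N) → (ℕ → ℤ) → ℕ → Poly N
comb N g c zero    = 0P N
comb N g c (suc j) = comb N g c j +P (c (suc j) ·P g (suc j))

InSpan : (N : ℕ) → (ℕ → Poly N) → Poly N → Set
InSpan N g p = ∃ λ (c : ℕ → ℤ) → ∀ i → p i ≡ comb N g c (N ∸ 1) i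

-- Abelian groups given as a carrier, a membership predicate, an equivalence
-- (the quotient relation), addition and zero.

record QGroup : Set₁ where
  field
    Carrier : Set
    Elem    : Carrier → Set
    _≈_     : Carrier → Carrier → Set
    _⊕_     : Carrier → Carrier → Carrier
    0#      : Carrier

-- Z_N / span(R_1,…,R_{N-1}).  An element of Z_N (= ℤ-span of e_1..e_{N-1})
-- is represented by its coefficients x_v with respect to e_1,…,e_{N-1}
-- (entries with v = 0 or v ≥ N are ignored).
Presented : (N : ℕ) → (ℕ → Poly N) → QGroup
Presented N R = record
  { Carrier = ℕ → ℤ
  ; Elem    = λ _ → ⊤
  ; _≈_     = λ x y → InSpan N R (comb N (e N) x (N ∸ 1) -P comb N (e N) y (N ∸ 1))
  ; _⊕_     = λ x y v → x v ℤ.+ y v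
  ; 0#      = λ _ → + 0
  }

SigmaG : (N d : ℕ) → QGroup
SigmaG N d = Presented N (ε N d)

SandG : (N d : ℕ) → QGroup
SandG N d = Presented N (f N d)

times : (G : QGroup) → ℕ → QGroup.Carrier G → QGroup.Carrier G
times G zero    x = QGroup.0# G
times G (suc K) x = QGroup._⊕_ G (times G K x) x

Kernel : QGroup → ℕ → QGroup
Kernel G K = record
  { Carrier = Carrier
  ; Elem    = λ x → Elem x × (times G K x ≈ 0#)
  ; _≈_     = _≈_
  ; _⊕_     = _⊕_
  ; 0#      = 0#
  }
  where open QGroup G

_⊕G_ : QGroup → QGroup → QGroup
G ⊕G H = record
  { Carrier = G.Carrier × H.Carrier
  ; Elem    = λ { (x , y) → G.Elem x × H.Elem y }
  ; _≈_     = λ { (x , y) (x′ , y′) → G._≈_ x x′ × H._≈_ y y′ }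
  ; _⊕_     = λ { (x , y) (x′ , y′) → G._⊕_ x x′ , H._⊕_ y y′ }
  ; 0#      = G.0# , H.0#
  }
  where
    module G = QGroup G
    module H = QGroup H

record Iso (G H : QGroup) : Set where
  private
    module G = QGroup G
    module H = QGroup H
  field
    to    : G.Carrier → H.Carrier
    elem  : ∀ x → G.Elem x → H.Elem (to x)
    wd    : ∀ x y → G.Elem x → G.Elem y → G._≈_ x y → H._≈_ (to x) (to y)
    hom   : ∀ x y → G.Elem x → G.Elem y → H._≈_ (to (G._⊕_ x y)) (H._⊕_ (to x) (to y))
    inj   : ∀ x y → G.Elem x → G.Elem y → H._≈_ (to x) (to y) → G._≈_ x y
    surj  : ∀ y → H.Elem y → Σ G.Carrier λ x → G.Elem x × H._≈_ (to x) y

module Submission where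

-- Write n = δm with δ ∣ D = d^k and gcd(m,d) = 1.  As d is a unit modulo m there is
-- M = d^(o+1) - 1 with m ∣ M, and (1+M)^k ≡ 1 (mod M) gives a·D = 1 + b·M for
-- a = d^(ok).  The isomorphism is  x ↦ ((1 - aD)x , ρ x),  where ρ reduces exponents
-- modulo m.  The first component lies in the D-torsion because (1 - aD)x = -bMx and
-- n ∣ DM; a left inverse on the second component is the zero-extension ι of exponents
-- below m, which inverts ρ after multiplication by D.  Injectivity and surjectivity then
-- come from splitting an element as (1 - aD)x + aDx.

open import Defs
open import Data.Nat using (ℕ; _≤_; _<_; _^_)
open import Data.Product using (_×_)
open import Relation.Binary.PropositionalEquality using (_≡_; _≢_)

open import Data.Nat as ℕ using (zero; suc; z≤n; s≤s; _%_; _∸_)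
import Data.Nat.Properties as ℕP
import Data.Nat.DivMod as DM
import Data.Nat.Divisibility as Div
open Div using (_∣_; divides)
open import Data.Nat.Coprimality using (Coprime; coprime-divisor; gcd≡1⇒coprime)
open import Data.Nat.GCD using (gcd; gcd[m,n]∣n; gcd[m,n]∣m; gcd[m,n]≡0⇒n≡0)
import Data.Nat.Tactic.RingSolver as ℕSolver
open import Data.Integer as ℤ using (ℤ; +_)
import Data.Integer.Properties as ℤP
open import Data.Integer.Tactic.RingSolver using (solve-∀)
open import Data.Fin using (Fin; toℕ)
import Data.Fin as Fin
import Data.Fin.Properties as FinP
open import Data.Product using (Σ; _,_; proj₁; proj₂)
open import Data.Unit using (tt)
open import Data.Empty using (⊥-elim)
open import Relation.Binary.PropositionalEquality using (refl; sym; trans; cong; cong₂; subst; module ≡-Reasoning)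
open import Relation.Nullary using (yes; no)
open import Algebra.Properties.Semiring.Sum ℤP.+-*-semiring
  using (sum; sum-cong-≗; sum-replicate-zero; ∑-distrib-+; *-distribˡ-sum)
open import Algebra.Properties.AbelianGroup ℤP.+-0-abelianGroup using (∙-cancelˡ)

infix 4 _≐_
_≐_ : ∀ {N} → Poly N → Poly N → Set
p ≐ q = ∀ i → p i ≡ q i

≐-refl : ∀ {N} {p : Poly N} → p ≐ p
≐-refl i = refl

≐-sym : ∀ {N} {p q : Poly N} → p ≐ q → q ≐ p
≐-sym h i = sym (h i)

≐-trans : ∀ {N} {p q r : Poly N} → p ≐ q → q ≐ r → p ≐ r
≐-trans h h' i = trans (h i) (h' i)

+P-cong : ∀ {N} {p p' q q' : Poly N} → p ≐ p' → q ≐ q' → (p +P q) ≐ (p' +P q')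
+P-cong h h' i = cong₂ ℤ._+_ (h i) (h' i)

-P-cong : ∀ {N} {p p' q q' : Poly N} → p ≐ p' → q ≐ q' → (p -P q) ≐ (p' -P q')
-P-cong h h' i = cong₂ ℤ._-_ (h i) (h' i)

·P-cong : ∀ {N} (a : ℤ) {p p' : Poly N} → p ≐ p' → (a ·P p) ≐ (a ·P p')
·P-cong a h i = cong (a ℤ.*_) (h i)

·P-distrib-- : ∀ {N} (a : ℤ) (p q : Poly N) → (a ·P (p -P q)) ≐ ((a ·P p) -P (a ·P q))
·P-distrib-- a p q i = lemma a (p i) (q i)
  where
    lemma : ∀ a x y → a ℤ.* (x ℤ.- y) ≡ a ℤ.* x ℤ.- a ℤ.* y
    lemma = solve-∀

module LinearCombination {N : ℕ} where
  comb-cong-c : (g : ℕ → Poly N) (c c' : ℕ → ℤ) (j : ℕ) → (∀ v → v < j → c (suc v) ≡ c' (suc v))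
              → comb N g c j ≐ comb N g c' j
  comb-cong-c g c c' zero h i = refl
  comb-cong-c g c c' (suc j) h i =
    cong₂ ℤ._+_ (comb-cong-c g c c' j (λ v v<j → h v (ℕP.m<n⇒m<1+n v<j)) i)
                (cong (λ z → z ℤ.* g (suc j) i) (h j ℕP.≤-refl))

  comb-cong-g : (g g' : ℕ → Poly N) (c : ℕ → ℤ) (j : ℕ) → (∀ v → v < j → g (suc v) ≐ g' (suc v))
              → comb N g c j ≐ comb N g' c j
  comb-cong-g g g' c zero h i = refl
  comb-cong-g g g' c (suc j) h i =
    cong₂ ℤ._+_ (comb-cong-g g g' c j (λ v v<j → h v (ℕP.m<n⇒m<1+n v<j)) i)
                (cong (c (suc j) ℤ.*_) (h j ℕP.≤-refl i))

  comb-add : (g : ℕ → Poly N) (c c' : ℕ → ℤ) (j : ℕ)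
           → comb N g (λ v → c v ℤ.+ c' v) j ≐ (comb N g c j +P comb N g c' j)
  comb-add g c c' zero i = refl
  comb-add g c c' (suc j) i =
    trans (cong (ℤ._+ ((c (suc j) ℤ.+ c' (suc j)) ℤ.* g (suc j) i)) (comb-add g c c' j i))
          (lemma (comb N g c j i) (comb N g c' j i) (c (suc j)) (c' (suc j)) (g (suc j) i))
    where
      lemma : ∀ (A B x y z : ℤ) → (A ℤ.+ B) ℤ.+ (x ℤ.+ y) ℤ.* z ≡ (A ℤ.+ x ℤ.* z) ℤ.+ (B ℤ.+ y ℤ.* z)
      lemma = solve-∀

  comb-scale : (g : ℕ → Poly N) (a : ℤ) (c : ℕ → ℤ) (j : ℕ)
             → comb N g (λ v → a ℤ.* c v) j ≐ (a ·P comb N g c j)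
  comb-scale g a c zero i = sym (ℤP.*-zeroʳ a)
  comb-scale g a c (suc j) i =
    trans (cong (ℤ._+ ((a ℤ.* c (suc j)) ℤ.* g (suc j) i)) (comb-scale g a c j i))
          (lemma a (comb N g c j i) (c (suc j)) (g (suc j) i))
    where
      lemma : ∀ (a A x z : ℤ) → a ℤ.* A ℤ.+ (a ℤ.* x) ℤ.* z ≡ a ℤ.* (A ℤ.+ x ℤ.* z)
      lemma = solve-∀

  comb-gsub : (g g' : ℕ → Poly N) (c : ℕ → ℤ) (j : ℕ)
            → comb N (λ v → g v -P g' v) c j ≐ (comb N g c j -P comb N g' c j)
  comb-gsub g g' c zero i = refl
  comb-gsub g g' c (suc j) i =
    trans (cong (ℤ._+ (c (suc j) ℤ.* (g (suc j) i ℤ.- g' (suc j) i))) (comb-gsub g g' c j i))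
          (lemma (comb N g c j i) (comb N g' c j i) (c (suc j)) (g (suc j) i) (g' (suc j) i))
    where
      lemma : ∀ (A B x y z : ℤ) → (A ℤ.- B) ℤ.+ x ℤ.* (y ℤ.- z) ≡ (A ℤ.+ x ℤ.* y) ℤ.- (B ℤ.+ x ℤ.* z)
      lemma = solve-∀

  comb-gscale : (g : ℕ → Poly N) (a : ℤ) (c : ℕ → ℤ) (j : ℕ)
              → comb N (λ v → a ·P g v) c j ≐ (a ·P comb N g c j)
  comb-gscale g a c zero i = sym (ℤP.*-zeroʳ a)
  comb-gscale g a c (suc j) i =
    trans (cong (ℤ._+ (c (suc j) ℤ.* (a ℤ.* g (suc j) i))) (comb-gscale g a c j i))
          (lemma a (comb N g c j i) (c (suc j)) (g (suc j) i))
    where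
      lemma : ∀ (a A x z : ℤ) → a ℤ.* A ℤ.+ x ℤ.* (a ℤ.* z) ≡ a ℤ.* (A ℤ.+ x ℤ.* z)
      lemma = solve-∀

  comb-zero : (g : ℕ → Poly N) (j : ℕ) → comb N g (λ _ → + 0) j ≐ 0P N
  comb-zero g zero i = refl
  comb-zero g (suc j) i = cong (ℤ._+ + 0) (comb-zero g j i)

  comb-trunc : (g : ℕ → Poly N) (c : ℕ → ℤ) (j t : ℕ) → (∀ v → j ≤ v → c (suc v) ≡ + 0)
             → comb N g c (j ℕ.+ t) ≐ comb N g c j
  comb-trunc g c j zero h i rewrite ℕP.+-identityʳ j = refl
  comb-trunc g c j (suc t) h i rewrite ℕP.+-suc j t =
    trans (cong₂ (λ a b → a ℤ.+ b ℤ.* g (suc (j ℕ.+ t)) i) (comb-trunc g c j t h i) (h (j ℕ.+ t) (ℕP.m≤m+n j t)))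
          (ℤP.+-identityʳ _)

open LinearCombination public

kron : ℕ → ℕ → ℤ
kron zero    zero    = + 1
kron zero    (suc b) = + 0
kron (suc a) zero    = + 0
kron (suc a) (suc b) = kron a b

kron-eq : ∀ a → kron a a ≡ + 1
kron-eq zero    = refl
kron-eq (suc a) = kron-eq a

kron-neq : ∀ a b → a ≢ b → kron a b ≡ + 0
kron-neq zero    zero    h = ⊥-elim (h refl)
kron-neq zero    (suc b) h = refl
kron-neq (suc a) zero    h = refl
kron-neq (suc a) (suc b) h = kron-neq a b (λ eq → h (cong suc eq))

kron-sym : ∀ a b → kron a b ≡ kron b a
kron-sym zero    zero    = refl
kron-sym zero    (suc b) = refl
kron-sym (suc a) zero    = refl
kron-sym (suc a) (suc b) = kron-sym a b

X^-kron : ∀ N v (i : Fin N) → X^ N v i ≡ kron (toℕ i) (red N v)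
X^-kron N v i with toℕ i ℕ.≟ red N v
... | yes eq = trans (sym (kron-eq (red N v))) (cong (λ z → kron z (red N v)) (sym eq))
... | no ne  = sym (kron-neq _ _ ne)

X^-cong : ∀ N a b → red N a ≡ red N b → X^ N a ≐ X^ N b
X^-cong N a b eq i = trans (X^-kron N a i) (trans (cong (kron (toℕ i)) eq) (sym (X^-kron N b i)))

module SingleCoefficient {N : ℕ} (g : ℕ → Poly N) (w : ℕ) (a : ℤ) where
  single : ℕ → ℤ
  single u = kron w u ℤ.* a

  comb-single-below : ∀ j → j < w → comb N g single j ≐ 0P N
  comb-single-below zero    _  i = refl
  comb-single-below (suc j) lt i =
    cong₂ (λ x y → x ℤ.+ y ℤ.* a ℤ.* g (suc j) i)
          (comb-single-below j (ℕP.<-trans (ℕP.n<1+n j) lt) i)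
          (kron-neq w (suc j) (λ eq → ℕP.<-irrefl (sym eq) lt))

  comb-single : ∀ j → 1 ≤ w → w ≤ j → comb N g single j ≐ (a ·P g w)
  comb-single zero (s≤s _) () i
  comb-single (suc j) 1≤w w≤j i with w ℕ.≟ suc j
  ... | yes refl =
    trans (cong₂ (λ x y → x ℤ.+ y ℤ.* a ℤ.* g (suc j) i) (comb-single-below j ℕP.≤-refl i) (kron-eq (suc j)))
          (trans (ℤP.+-identityˡ _) (cong (ℤ._* g (suc j) i) (ℤP.*-identityˡ a)))
  ... | no ne =
    trans (cong₂ (λ x y → x ℤ.+ y ℤ.* a ℤ.* g (suc j) i)
                 (comb-single j 1≤w (ℕP.≤-pred (ℕP.≤∧≢⇒< w≤j ne)) i) (kron-neq w (suc j) ne))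
          (ℤP.+-identityʳ _)

  comb-single-0 : w ≡ 0 → ∀ j → comb N g single j ≐ 0P N
  comb-single-0 refl zero    i = refl
  comb-single-0 refl (suc j) i = cong (λ x → x ℤ.+ + 0 ℤ.* a ℤ.* g (suc j) i) (comb-single-0 refl j i)

open SingleCoefficient public

module Span (N : ℕ) (R : ℕ → Poly N) where
  Sp : Poly N → Set
  Sp p = InSpan N R p

  sp-ext : ∀ {p q} → p ≐ q → Sp p → Sp q
  sp-ext h (c , eq) = c , λ i → trans (sym (h i)) (eq i)

  sp0 : Sp (0P N)
  sp0 = (λ _ → + 0) , λ i → sym (comb-zero R (N ∸ 1) i)

  sp+ : ∀ {p q} → Sp p → Sp q → Sp (p +P q)
  sp+ (c , eq) (c' , eq') = (λ v → c v ℤ.+ c' v) ,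
    λ i → trans (cong₂ ℤ._+_ (eq i) (eq' i)) (sym (comb-add R c c' (N ∸ 1) i))

  sp· : ∀ a {p} → Sp p → Sp (a ·P p)
  sp· a (c , eq) = (λ v → a ℤ.* c v) ,
    λ i → trans (cong (a ℤ.*_) (eq i)) (sym (comb-scale R a c (N ∸ 1) i))

  sp- : ∀ {p q} → Sp p → Sp q → Sp (p -P q)
  sp- {p} {q} hp hq = sp-ext (λ i → lemma (p i) (q i)) (sp+ hp (sp· (ℤ.- + 1) hq))
    where
      lemma : ∀ x y → x ℤ.+ (ℤ.- + 1) ℤ.* y ≡ x ℤ.- y
      lemma = solve-∀

  sp-comb : (g : ℕ → Poly N) → (∀ v → Sp (g v)) → ∀ c j → Sp (comb N g c j)
  sp-comb g h c zero    = sp0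
  sp-comb g h c (suc j) = sp+ (sp-comb g h c j) (sp· (c (suc j)) (h (suc j)))

  sp-gen : ∀ v → 1 ≤ v → v ≤ N ∸ 1 → Sp (R v)
  sp-gen v 1≤v v≤N = single R v (+ 1) ,
    λ i → sym (trans (comb-single R v (+ 1) (N ∸ 1) 1≤v v≤N i) (ℤP.*-identityˡ _))

  infix 4 _≋_
  record _≋_ (p q : Poly N) : Set where
    constructor ≋i
    field unw : Sp (p -P q)
  open _≋_ public

  ≐⇒≋ : ∀ {p q} → p ≐ q → p ≋ q
  ≐⇒≋ {p} {q} h = ≋i (sp-ext (λ i → sym (trans (cong (λ z → p i ℤ.- z) (sym (h i))) (ℤP.+-inverseʳ (p i)))) sp0)

  ≋-sym : ∀ {p q} → p ≋ q → q ≋ p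
  ≋-sym {p} {q} (≋i h) = ≋i (sp-ext (λ i → lemma (p i) (q i)) (sp· (ℤ.- + 1) h))
    where
      lemma : ∀ x y → (ℤ.- + 1) ℤ.* (x ℤ.- y) ≡ y ℤ.- x
      lemma = solve-∀

  ≋-trans : ∀ {p q r} → p ≋ q → q ≋ r → p ≋ r
  ≋-trans {p} {q} {r} (≋i h) (≋i h') = ≋i (sp-ext (λ i → lemma (p i) (q i) (r i)) (sp+ h h'))
    where
      lemma : ∀ x y z → (x ℤ.- y) ℤ.+ (y ℤ.- z) ≡ x ℤ.- z
      lemma = solve-∀

  ≋-+ : ∀ {p p' q q'} → p ≋ p' → q ≋ q' → (p +P q) ≋ (p' +P q')
  ≋-+ {p} {p'} {q} {q'} (≋i h) (≋i h') = ≋i (sp-ext (λ i → lemma (p i) (p' i) (q i) (q' i)) (sp+ h h'))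
    where
      lemma : ∀ x x' y y' → (x ℤ.- x') ℤ.+ (y ℤ.- y') ≡ (x ℤ.+ y) ℤ.- (x' ℤ.+ y')
      lemma = solve-∀

  ≋-- : ∀ {p p' q q'} → p ≋ p' → q ≋ q' → (p -P q) ≋ (p' -P q')
  ≋-- {p} {p'} {q} {q'} (≋i h) (≋i h') = ≋i (sp-ext (λ i → lemma (p i) (p' i) (q i) (q' i)) (sp- h h'))
    where
      lemma : ∀ x x' y y' → (x ℤ.- x') ℤ.- (y ℤ.- y') ≡ (x ℤ.- y) ℤ.- (x' ℤ.- y')
      lemma = solve-∀

  ≋-· : ∀ a {p p'} → p ≋ p' → (a ·P p) ≋ (a ·P p')
  ≋-· a {p} {p'} (≋i h) = ≋i (sp-ext (·P-distrib-- a p p') (sp· a h))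

  ≋-comb : (g g' : ℕ → Poly N) → (∀ v → g v ≋ g' v) → ∀ c j → comb N g c j ≋ comb N g' c j
  ≋-comb g g' h c j = ≋i (sp-ext (comb-gsub g g' c j) (sp-comb _ (λ v → unw (h v)) c j))

  sp-resp : ∀ {p q} → p ≋ q → Sp q → Sp p
  sp-resp {p} {q} (≋i h) hq = sp-ext (λ i → lemma (p i) (q i)) (sp+ h hq)
    where
      lemma : ∀ x y → (x ℤ.- y) ℤ.+ y ≡ x
      lemma = solve-∀

  ≋0⇒Sp : ∀ {p} → p ≋ 0P N → Sp p
  ≋0⇒Sp h = sp-resp h sp0

module Cyclic (N' : ℕ) where
  N : ℕ
  N = suc N'

  X-modeq : ∀ a b → a % N ≡ b % N → X^ N a ≐ X^ N b
  X-modeq a b eq = X^-cong N a b eq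

  X-shift : ∀ a s → N ∣ s → X^ N (a ℕ.+ s) ≐ X^ N a
  X-shift a s h = X-modeq _ _ (DM.%-remove-+ʳ a h)

  X-mod : ∀ a → X^ N (a % N) ≐ X^ N a
  X-mod a = X-modeq _ _ (DM.m%n%n≡m%n a N)

  geo-split : ∀ a j t → geo N a (j ℕ.+ t) ≐ (geo N a j +P geo N (a ℕ.+ j) t)
  geo-split a j zero i rewrite ℕP.+-identityʳ j = sym (ℤP.+-identityʳ _)
  geo-split a j (suc t) i rewrite ℕP.+-suc j t =
    trans (cong₂ ℤ._+_ (geo-split a j t i) (cong (λ z → X^ N z i) (sym (ℕP.+-assoc a j t))))
          (ℤP.+-assoc (geo N a j i) _ _)

  geo-modeq : ∀ a b K → a % N ≡ b % N → geo N a K ≐ geo N b K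
  geo-modeq a b zero    eq i = refl
  geo-modeq a b (suc K) eq i =
    cong₂ ℤ._+_ (geo-modeq a b K eq i)
      (X-modeq (a ℕ.+ K) (b ℕ.+ K)
        (trans (DM.%-distribˡ-+ a K N) (trans (cong (λ z → (z ℕ.+ K % N) % N) eq) (sym (DM.%-distribˡ-+ b K N)))) i)

  geo-block : ∀ a → geo N a N ≐ geo N 0 N
  geo-block zero    i = refl
  geo-block (suc a) i = trans (∙-cancelˡ (geo N a 1 i) _ _ shifted) (geo-block a i)
    where
      open ≡-Reasoning
      shifted : geo N a 1 i ℤ.+ geo N (suc a) N i ≡ geo N a 1 i ℤ.+ geo N a N i
      shifted = begin
        geo N a 1 i ℤ.+ geo N (suc a) N i     ≡⟨ cong (λ z → geo N a 1 i ℤ.+ geo N z N i) (ℕP.+-comm 1 a) ⟩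
        geo N a 1 i ℤ.+ geo N (a ℕ.+ 1) N i   ≡⟨ sym (geo-split a 1 N i) ⟩
        geo N a (1 ℕ.+ N) i                   ≡⟨ cong (λ z → geo N a z i) (ℕP.+-comm 1 N) ⟩
        geo N a (N ℕ.+ 1) i                   ≡⟨ geo-split a N 1 i ⟩
        geo N a N i ℤ.+ geo N (a ℕ.+ N) 1 i   ≡⟨ cong (λ z → geo N a N i ℤ.+ z) (geo-modeq _ _ 1 (DM.[m+n]%n≡m%n a N) i) ⟩
        geo N a N i ℤ.+ geo N a 1 i           ≡⟨ ℤP.+-comm (geo N a N i) _ ⟩
        geo N a 1 i ℤ.+ geo N a N i           ∎

  geo-mult : ∀ a t → geo N a (t ℕ.* N) ≐ ((+ t) ·P geo N 0 N)
  geo-mult a zero    i = refl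
  geo-mult a (suc t) i =
    trans (geo-split a N (t ℕ.* N) i)
      (trans (cong₂ ℤ._+_ (geo-block a i) (geo-mult (a ℕ.+ N) t i)) (lemma (+ t) (geo N 0 N i)))
    where
      lemma : ∀ (t x : ℤ) → x ℤ.+ t ℤ.* x ≡ (+ 1 ℤ.+ t) ℤ.* x
      lemma = solve-∀

  geo-dvd : ∀ a b K → N ∣ K → geo N a K ≐ geo N b K
  geo-dvd a b K (divides t refl) = ≐-trans (geo-mult a t) (≐-sym (geo-mult b t))

sum-kron : ∀ n (H : ℕ → ℤ) r → r < n → sum (λ (j : Fin n) → H (toℕ j) ℤ.* kron (toℕ j) r) ≡ H r
sum-kron (suc n) H zero lt =
  trans (cong₂ ℤ._+_ (ℤP.*-identityʳ (H 0)) (trans (sum-cong-≗ {n} (λ j → ℤP.*-zeroʳ (H (suc (toℕ j))))) (sum-replicate-zero n)))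
        (ℤP.+-identityʳ _)
sum-kron (suc n) H (suc r) (s≤s lt) =
  trans (cong₂ ℤ._+_ (ℤP.*-zeroʳ (H 0)) (sum-kron n (λ t → H (suc t)) r lt)) (ℤP.+-identityˡ _)

-- For m ∣ n: the ring map ρ : ℤ[x]/(x^n-1) → ℤ[x]/(x^m-1) reducing exponents modulo m,
-- and the additive map ι back, extending coefficients of exponents < m by zero.
-- ρ is a homomorphism sending x^a to x^a; ι sends x^a to x^(a mod m) (ι-X).
module ReduceLift (n' m' : ℕ) (m∣n : suc m' ∣ suc n') where
  n : ℕ
  n = suc n'
  m : ℕ
  m = suc m'

  m≤n : m ≤ n
  m≤n = Div.∣⇒≤ m∣n

  κ : Fin m → Fin n → ℤ
  κ i j = kron (toℕ j % m) (toℕ i)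

  ρ : Poly n → Poly m
  ρ p i = sum (λ j → κ i j ℤ.* p j)

  ρ-cong : ∀ {p q} → p ≐ q → ρ p ≐ ρ q
  ρ-cong h i = sum-cong-≗ {n} (λ j → cong (κ i j ℤ.*_) (h j))

  ρ-+ : ∀ p q → ρ (p +P q) ≐ (ρ p +P ρ q)
  ρ-+ p q i = trans (sum-cong-≗ {n} (λ j → ℤP.*-distribˡ-+ (κ i j) (p j) (q j)))
                    (∑-distrib-+ {n} (λ j → κ i j ℤ.* p j) (λ j → κ i j ℤ.* q j))

  ρ-· : ∀ a p → ρ (a ·P p) ≐ (a ·P ρ p)
  ρ-· a p i = trans (sum-cong-≗ {n} (λ j → lemma (κ i j) a (p j)))
                    (sym (*-distribˡ-sum a (λ j → κ i j ℤ.* p j)))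
    where
      lemma : ∀ x a y → x ℤ.* (a ℤ.* y) ≡ a ℤ.* (x ℤ.* y)
      lemma = solve-∀

  ρ-- : ∀ p q → ρ (p -P q) ≐ (ρ p -P ρ q)
  ρ-- p q i =
    trans (ρ-cong (λ j → lemma (p j) (q j)) i)
      (trans (ρ-+ p ((ℤ.- + 1) ·P q) i) (cong (λ z → ρ p i ℤ.+ z) (trans (ρ-· (ℤ.- + 1) q i) (lemma′ (ρ q i)))))
    where
      lemma : ∀ x y → x ℤ.- y ≡ x ℤ.+ (ℤ.- + 1) ℤ.* y
      lemma = solve-∀
      lemma′ : ∀ x → (ℤ.- + 1) ℤ.* x ≡ ℤ.- x
      lemma′ = solve-∀

  ρ-0 : ρ (0P n) ≐ 0P m
  ρ-0 i = trans (sum-cong-≗ {n} (λ j → ℤP.*-zeroʳ (κ i j))) (sum-replicate-zero n)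

  ρ-comb : ∀ (g : ℕ → Poly n) c j → ρ (comb n g c j) ≐ comb m (λ v → ρ (g v)) c j
  ρ-comb g c zero    = ρ-0
  ρ-comb g c (suc j) i =
    trans (ρ-+ (comb n g c j) (c (suc j) ·P g (suc j)) i) (cong₂ ℤ._+_ (ρ-comb g c j i) (ρ-· (c (suc j)) (g (suc j)) i))

  ρ-X : ∀ a → ρ (X^ n a) ≐ X^ m a
  ρ-X a i =
    trans (sum-cong-≗ {n} (λ j → cong (κ i j ℤ.*_) (X^-kron n a j)))
      (trans (sum-kron n (λ t → kron (t % m) (toℕ i)) (a % n) (DM.m%n<n a n))
        (trans (cong (λ z → kron z (toℕ i)) (DM.m∣n⇒o%n%m≡o%m m n a m∣n))
          (trans (kron-sym (a % m) (toℕ i)) (sym (X^-kron m a i)))))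

  ρ-e : ∀ v → ρ (e n v) ≐ e m v
  ρ-e v = ≐-trans (ρ-- (X^ n v) (X^ n 0)) (-P-cong (ρ-X v) (ρ-X 0))

  ι : Poly m → Poly n
  ι p j with toℕ j ℕ.<? m
  ... | yes lt = p (Fin.fromℕ< lt)
  ... | no _   = + 0

  ι-cong : ∀ {p q} → p ≐ q → ι p ≐ ι q
  ι-cong h j with toℕ j ℕ.<? m
  ... | yes lt = h _
  ... | no _   = refl

  ι-+ : ∀ p q → ι (p +P q) ≐ (ι p +P ι q)
  ι-+ p q j with toℕ j ℕ.<? m
  ... | yes lt = refl
  ... | no _   = refl

  ι-- : ∀ p q → ι (p -P q) ≐ (ι p -P ι q)
  ι-- p q j with toℕ j ℕ.<? m
  ... | yes lt = refl
  ... | no _   = refl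

  ι-· : ∀ a p → ι (a ·P p) ≐ (a ·P ι p)
  ι-· a p j with toℕ j ℕ.<? m
  ... | yes lt = refl
  ... | no _   = sym (ℤP.*-zeroʳ a)

  ι-0 : ι (0P m) ≐ 0P n
  ι-0 j with toℕ j ℕ.<? m
  ... | yes lt = refl
  ... | no _   = refl

  ι-comb : ∀ (g : ℕ → Poly m) c j → ι (comb m g c j) ≐ comb n (λ v → ι (g v)) c j
  ι-comb g c zero    = ι-0
  ι-comb g c (suc j) i =
    trans (ι-+ (comb m g c j) _ i) (cong₂ ℤ._+_ (ι-comb g c j i) (ι-· (c (suc j)) (g (suc j)) i))

  mod-m<n : ∀ a → a % m < n
  mod-m<n a = ℕP.<-≤-trans (DM.m%n<n a m) m≤n

  ι-X : ∀ a → ι (X^ m a) ≐ X^ n (a % m)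
  ι-X a j with toℕ j ℕ.<? m
  ... | yes lt = trans (X^-kron m a _)
                   (trans (cong (λ z → kron z (a % m)) (FinP.toℕ-fromℕ< lt))
                     (trans (cong (kron (toℕ j)) (sym (DM.m<n⇒m%n≡m (mod-m<n a)))) (sym (X^-kron n (a % m) j))))
  ... | no nlt = sym (trans (X^-kron n (a % m) j)
                   (trans (cong (kron (toℕ j)) (DM.m<n⇒m%n≡m (mod-m<n a)))
                     (kron-neq _ _ (λ eq → nlt (subst (_< m) (sym eq) (DM.m%n<n a m))))))

mod-diff : ∀ m .{{_ : ℕ.NonZero m}} a b → a % m ≡ b % m → m ∣ a ∸ b
mod-diff m a b eq = divides (a ℕ./ m ∸ b ℕ./ m) (begin
    a ∸ b
      ≡⟨ cong₂ _∸_ (DM.m≡m%n+[m/n]*n a m) (DM.m≡m%n+[m/n]*n b m) ⟩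
    (a % m ℕ.+ (a ℕ./ m) ℕ.* m) ∸ (b % m ℕ.+ (b ℕ./ m) ℕ.* m)
      ≡⟨ cong (λ t → (a % m ℕ.+ (a ℕ./ m) ℕ.* m) ∸ (t ℕ.+ (b ℕ./ m) ℕ.* m)) (sym eq) ⟩
    (a % m ℕ.+ (a ℕ./ m) ℕ.* m) ∸ (a % m ℕ.+ (b ℕ./ m) ℕ.* m)
      ≡⟨ ℕP.[m+n]∸[m+o]≡n∸o (a % m) _ _ ⟩
    (a ℕ./ m) ℕ.* m ∸ (b ℕ./ m) ℕ.* m
      ≡⟨ sym (ℕP.*-distribʳ-∸ m (a ℕ./ m) (b ℕ./ m)) ⟩
    (a ℕ./ m ∸ b ℕ./ m) ℕ.* m ∎)
  where open ≡-Reasoning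

cancel-power : ∀ {m d} → Coprime m d → ∀ I X → m ∣ d ^ I ℕ.* X → m ∣ X
cancel-power {m} c zero    X h = subst (m ∣_) (ℕP.+-identityʳ X) h
cancel-power {m} {d} c (suc I) X h =
  cancel-power c I X (coprime-divisor c (subst (m ∣_) (ℕP.*-assoc d (d ^ I) X) h))

-- d is a unit modulo m: some positive power of d is ≡ 1 (mod m).  Among d^0, …, d^m two
-- powers d^I, d^J (I < J) agree mod m, so m ∣ d^I (d^(J-I) - 1) and d^I cancels.
order : ∀ m' d → Coprime (suc m') d → Σ ℕ λ o → suc m' ∣ d ^ suc o ∸ 1
order m' d c with FinP.pigeonhole (ℕP.n<1+n (suc m')) (λ (i : Fin (suc (suc m'))) → Fin.fromℕ< (DM.m%n<n (d ^ toℕ i) (suc m')))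
... | i , j , i<j , eq = gap , cancel-power c I (d ^ suc gap ∸ 1) (subst (m ∣_) factor (mod-diff m (d ^ J) (d ^ I) same-residue))
  where
    open ≡-Reasoning
    m = suc m'
    I = toℕ i
    J = toℕ j
    same-residue : d ^ J % m ≡ d ^ I % m
    same-residue = sym (trans (sym (FinP.toℕ-fromℕ< (DM.m%n<n (d ^ I) m)))
                        (trans (cong toℕ eq) (FinP.toℕ-fromℕ< (DM.m%n<n (d ^ J) m))))
    gap : ℕ
    gap = J ∸ suc I
    J≡I+gap : J ≡ I ℕ.+ suc gap
    J≡I+gap = sym (trans (ℕP.+-suc I gap) (ℕP.m+[n∸m]≡n i<j))
    factor : d ^ J ∸ d ^ I ≡ d ^ I ℕ.* (d ^ suc gap ∸ 1)
    factor = begin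
      d ^ J ∸ d ^ I                      ≡⟨ cong (λ t → d ^ t ∸ d ^ I) J≡I+gap ⟩
      d ^ (I ℕ.+ suc gap) ∸ d ^ I        ≡⟨ cong₂ _∸_ (ℕP.^-distribˡ-+-* d I (suc gap)) (sym (ℕP.*-identityʳ (d ^ I))) ⟩
      d ^ I ℕ.* d ^ suc gap ∸ d ^ I ℕ.* 1 ≡⟨ sym (ℕP.*-distribˡ-∸ (d ^ I) (d ^ suc gap) 1) ⟩
      d ^ I ℕ.* (d ^ suc gap ∸ 1)        ∎

power-of-1+M : ∀ M k → Σ ℕ λ b → (1 ℕ.+ M) ^ k ≡ 1 ℕ.+ b ℕ.* M
power-of-1+M M zero    = 0 , refl
power-of-1+M M (suc k) with power-of-1+M M k
... | b , h = (1 ℕ.+ b ℕ.+ b ℕ.* M) , trans (cong ((1 ℕ.+ M) ℕ.*_) h) (expand M b)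
  where
    expand : ∀ M b → (1 ℕ.+ M) ℕ.* (1 ℕ.+ b ℕ.* M) ≡ 1 ℕ.+ (1 ℕ.+ b ℕ.+ b ℕ.* M) ℕ.* M
    expand = ℕSolver.solve-∀

power-inverse : ∀ d' o k → Σ ℕ λ b → suc d' ^ (o ℕ.* k) ℕ.* suc d' ^ k ≡ 1 ℕ.+ b ℕ.* (suc d' ^ suc o ∸ 1)
power-inverse d' o k = b , (begin
    d ^ (o ℕ.* k) ℕ.* d ^ k   ≡⟨ sym (ℕP.^-distribˡ-+-* d (o ℕ.* k) k) ⟩
    d ^ (o ℕ.* k ℕ.+ k)       ≡⟨ cong (d ^_) (ℕP.+-comm (o ℕ.* k) k) ⟩
    d ^ (suc o ℕ.* k)         ≡⟨ sym (ℕP.^-*-assoc d (suc o) k) ⟩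
    (d ^ suc o) ^ k           ≡⟨ cong (_^ k) d^[1+o]≡1+M ⟩
    (1 ℕ.+ M) ^ k             ≡⟨ proj₂ (power-of-1+M M k) ⟩
    1 ℕ.+ b ℕ.* M             ∎)
  where
    open ≡-Reasoning
    d = suc d'
    M = d ^ suc o ∸ 1
    b = proj₁ (power-of-1+M M k)
    d^[1+o]≡1+M : d ^ suc o ≡ 1 ℕ.+ M
    d^[1+o]≡1+M = sym (ℕP.m+[n∸m]≡n (ℕP.m^n>0 d (suc o)))

-- The properties of a family of relations R_N ⊆ ℤ[x]/(x^N - 1) (for a fixed d) from which
-- the splitting theorem follows; ε and f both satisfy them (sigmaFamily, sandpileFamily).
record RelationFamily (d : ℕ) : Set where
  field
    R : (N : ℕ) → ℕ → Poly N
    -- every R_v (v ∈ ℕ, not only 0 < v < N) lies in the span of R_1, …, R_{N-1}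
    rel-in-span : ∀ N' v → InSpan (suc N') (R (suc N')) (R (suc N') v)
    -- multiplication by d^j only sees exponents modulo N / gcd(N, d^j)
    power-shift : ∀ N' j t v → suc N' ∣ d ^ j ℕ.* t
                → Span._≋_ (suc N') (R (suc N')) ((+ (d ^ j)) ·P X^ (suc N') v)
                                                  ((+ (d ^ j)) ·P X^ (suc N') (v ℕ.+ t))
    power-kill : ∀ N' j j' L v → suc N' ∣ d ^ j ℕ.* L → d ^ j ℕ.+ d ^ j ℕ.* L ≡ d ^ j'
               → InSpan (suc N') (R (suc N')) ((+ (d ^ j ℕ.* L)) ·P e (suc N') v)
    reduce-rel : ∀ n' m' (m∣n : suc m' ∣ suc n') v → ReduceLift.ρ n' m' m∣n (R (suc n') v) ≐ R (suc m') v
    lift-rel : ∀ n' m' (m∣n : suc m' ∣ suc n') D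
             → (∀ w → Span._≋_ (suc n') (R (suc n'))
                        ((+ D) ·P ReduceLift.ι n' m' m∣n (X^ (suc m') w)) ((+ D) ·P X^ (suc n') w))
             → ∀ v → Span._≋_ (suc n') (R (suc n'))
                        ((+ D) ·P ReduceLift.ι n' m' m∣n (R (suc m') v)) ((+ D) ·P R (suc n') v)

module Splitting {d' : ℕ} (F : RelationFamily (suc d')) (n' m' k o' δ : ℕ)
  (δm≡n : δ ℕ.* suc m' ≡ suc n') (δ∣D : δ ∣ suc d' ^ k) (m∣M : suc m' ∣ suc d' ^ suc o' ∸ 1) where
  open RelationFamily F

  d n m D M : ℕ
  d = suc d'
  n = suc n'
  m = suc m'
  D = d ^ k
  M = d ^ suc o' ∸ 1

  m∣n : m ∣ n
  m∣n = divides δ (sym δm≡n)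

  n∣Dm : n ∣ D ℕ.* m
  n∣Dm = subst (_∣ D ℕ.* m) δm≡n (Div.*-monoˡ-∣ m δ∣D)

  n∣DM : n ∣ D ℕ.* M
  n∣DM = subst (_∣ D ℕ.* M) δm≡n (Div.*-pres-∣ δ∣D m∣M)

  d^[1+o]≡1+M : d ^ suc o' ≡ 1 ℕ.+ M
  d^[1+o]≡1+M = sym (ℕP.m+[n∸m]≡n (ℕP.m^n>0 d (suc o')))

  a b : ℕ
  a = d ^ (o' ℕ.* k)
  b = proj₁ (power-inverse d' o' k)

  aD≡1+bM : (+ a) ℤ.* (+ D) ≡ + 1 ℤ.+ (+ b) ℤ.* (+ M)
  aD≡1+bM = trans (sym (ℤP.pos-* a D))
              (trans (cong +_ (proj₂ (power-inverse d' o' k)))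
                (trans (ℤP.pos-+ 1 (b ℕ.* M)) (cong (ℤ._+_ (+ 1)) (ℤP.pos-* b M))))

  open ReduceLift n' m' m∣n hiding (n; m)
  module SN = Span n (R n)
  module SM = Span m (R m)
  open SN using () renaming (_≋_ to _≋ₙ_)

  -- D·x^w only depends on w modulo m, because n ∣ D·m.
  D-periodic : ∀ w → ((+ D) ·P X^ n w) ≋ₙ ((+ D) ·P X^ n (w % m))
  D-periodic w = SN.≋-sym (SN.≋-trans (power-shift n' k ((w ℕ./ m) ℕ.* m) (w % m) n∣D·shift)
                   (SN.≐⇒≋ (·P-cong (+ D) (X^-cong n _ _ (cong (_% n) (sym (DM.m≡m%n+[m/n]*n w m)))))))
    where
      n∣D·shift : n ∣ D ℕ.* ((w ℕ./ m) ℕ.* m)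
      n∣D·shift = Div.∣-trans n∣Dm (Div.*-monoʳ-∣ D (Div.n∣m*n (w ℕ./ m)))

  -- D·M kills Z_n, as d^k (1 + M) = d^(k+o+1) and n ∣ DM.
  DM-kills : ∀ v → SN.Sp (((+ D) ℤ.* (+ M)) ·P e n v)
  DM-kills v = SN.sp-ext (λ i → cong (ℤ._* e n v i) (ℤP.pos-* D M)) (power-kill n' k (k ℕ.+ suc o') M v n∣DM D+DM≡d^[k+o+1])
    where
      D+DM≡d^[k+o+1] : D ℕ.+ D ℕ.* M ≡ d ^ (k ℕ.+ suc o')
      D+DM≡d^[k+o+1] = sym (trans (ℕP.^-distribˡ-+-* d k (suc o'))
                         (trans (cong (D ℕ.*_) d^[1+o]≡1+M)
                           (trans (ℕP.*-distribˡ-+ D 1 M) (cong (ℕ._+ D ℕ.* M) (ℕP.*-identityʳ D)))))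

  -- M kills Z_m, as 1 + M = d^(o+1) and m ∣ M.
  M-kills : ∀ v → SM.Sp ((+ M) ·P e m v)
  M-kills v = SM.sp-ext (λ i → cong (λ t → + t ℤ.* e m v i) (ℕP.*-identityˡ M))
                (power-kill m' 0 (suc o') M v (subst (m ∣_) (sym (ℕP.*-identityˡ M)) m∣M) 1+M≡d^[o+1])
    where
      1+M≡d^[o+1] : d ^ 0 ℕ.+ d ^ 0 ℕ.* M ≡ d ^ suc o'
      1+M≡d^[o+1] = trans (cong (1 ℕ.+_) (ℕP.*-identityˡ M)) (sym d^[1+o]≡1+M)

  D-lift-rel : ∀ v → ((+ D) ·P ι (R m v)) ≋ₙ ((+ D) ·P R n v)
  D-lift-rel = lift-rel n' m' m∣n D
    (λ w → SN.≋-trans (SN.≐⇒≋ (·P-cong (+ D) (ι-X w))) (SN.≋-sym (D-periodic w)))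

  reduce-span : ∀ {p} → SN.Sp p → SM.Sp (ρ p)
  reduce-span (c , h) =
    SM.sp-ext (≐-sym (≐-trans (ρ-cong h) (≐-trans (ρ-comb (R n) c n')
                        (comb-cong-g _ (R m) c n' (λ v _ → reduce-rel n' m' m∣n (suc v))))))
      (SM.sp-comb (R m) (rel-in-span m') c n')

  lift-span : ∀ {q} → SM.Sp q → SN.Sp ((+ D) ·P ι q)
  lift-span (c , h) =
    SN.sp-ext (≐-sym (≐-trans (·P-cong (+ D) (≐-trans (ι-cong h) (ι-comb (R m) c m')))
                              (≐-sym (comb-gscale (λ v → ι (R m v)) (+ D) c m'))))
      (SN.sp-comb (λ v → (+ D) ·P ι (R m v))
                  (λ v → SN.sp-resp (D-lift-rel v) (SN.sp· (+ D) (rel-in-span n' v))) c m')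

  Pn : (ℕ → ℤ) → Poly n
  Pn x = comb n (e n) x n'

  Pm : (ℕ → ℤ) → Poly m
  Pm z = comb m (e m) z m'

  Pn-times : ∀ K x → Pn (times (Presented n (R n)) K x) ≐ ((+ K) ·P Pn x)
  Pn-times zero    x i = comb-zero (e n) n' i
  Pn-times (suc K) x i =
    trans (comb-add (e n) _ x n' i)
      (trans (cong (ℤ._+ Pn x i) (Pn-times K x i)) (lemma (+ K) (Pn x i)))
    where
      lemma : ∀ k y → k ℤ.* y ℤ.+ y ≡ (+ 1 ℤ.+ k) ℤ.* y
      lemma = solve-∀

  Pn-scale : ∀ c x → Pn (λ v → c ℤ.* x v) ≐ (c ·P Pn x)
  Pn-scale c x = comb-scale (e n) c x n'

  Pn-diff : ∀ x y → Pn (λ v → x v ℤ.- y v) ≐ (Pn x -P Pn y)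
  Pn-diff x y i =
    trans (comb-cong-c (e n) _ (λ v → x v ℤ.+ (ℤ.- + 1) ℤ.* y v) n' (λ v _ → cong (ℤ._+_ (x (suc v))) (neg (y (suc v)))) i)
      (trans (comb-add (e n) x _ n' i)
        (cong (λ t → Pn x i ℤ.+ t) (trans (Pn-scale (ℤ.- + 1) y i) (neg′ (Pn y i)))))
    where
      neg : ∀ t → ℤ.- t ≡ (ℤ.- + 1) ℤ.* t
      neg = solve-∀
      neg′ : ∀ t → (ℤ.- + 1) ℤ.* t ≡ ℤ.- t
      neg′ = solve-∀

  -- Coordinates of ρ (Pn x): the entries of x collected by residue modulo m.
  collect : ℕ → (ℕ → ℤ) → ℕ → ℤ
  collect zero    x u = + 0
  collect (suc J) x u = collect J x u ℤ.+ kron (suc J % m) u ℤ.* x (suc J)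

  collect-+ : ∀ J x y u → collect J (λ v → x v ℤ.+ y v) u ≡ collect J x u ℤ.+ collect J y u
  collect-+ zero    x y u = refl
  collect-+ (suc J) x y u =
    trans (cong (ℤ._+ kron (suc J % m) u ℤ.* (x (suc J) ℤ.+ y (suc J))) (collect-+ J x y u))
      (lemma (collect J x u) (collect J y u) (kron (suc J % m) u) (x (suc J)) (y (suc J)))
    where
      lemma : ∀ A B k p q → (A ℤ.+ B) ℤ.+ k ℤ.* (p ℤ.+ q) ≡ (A ℤ.+ k ℤ.* p) ℤ.+ (B ℤ.+ k ℤ.* q)
      lemma = solve-∀

  e-mod : ∀ v → e m v ≐ e m (v % m)
  e-mod v = -P-cong (≐-sym (X^-cong m _ _ (DM.m%n%n≡m%n v m))) ≐-refl

  e-0 : e m 0 ≐ 0P m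
  e-0 i = ℤP.+-inverseʳ (X^ m 0 i)

  collect-comb : ∀ x J → comb m (e m) x J ≐ Pm (collect J x)
  collect-comb x zero    = ≐-sym (comb-zero (e m) m')
  collect-comb x (suc J) =
    ≐-trans (+P-cong (collect-comb x J) last-term) (≐-sym (comb-add (e m) (collect J x) (single (e m) w (x (suc J))) m'))
    where
      w : ℕ
      w = suc J % m
      last-term : (x (suc J) ·P e m (suc J)) ≐ comb m (e m) (single (e m) w (x (suc J))) m'
      last-term with w ℕ.≟ 0
      ... | yes w≡0 = ≐-trans (·P-cong (x (suc J)) (≐-trans (e-mod (suc J)) (≐-trans (λ i → cong (λ t → e m t i) w≡0) e-0)))
                        (≐-trans (λ i → ℤP.*-zeroʳ (x (suc J))) (≐-sym (comb-single-0 (e m) w (x (suc J)) w≡0 m')))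
      ... | no w≢0  = ≐-trans (·P-cong (x (suc J)) (e-mod (suc J)))
                        (≐-sym (comb-single (e m) w (x (suc J)) m' (ℕP.n≢0⇒n>0 w≢0) (ℕP.≤-pred (DM.m%n<n (suc J) m))))

  reduce : (ℕ → ℤ) → ℕ → ℤ
  reduce = collect n'

  Pm-reduce : ∀ x → Pm (reduce x) ≐ ρ (Pn x)
  Pm-reduce x = ≐-sym (≐-trans (ρ-comb (e n) x n')
                  (≐-trans (comb-cong-g _ (e m) x n' (λ v _ → ρ-e (suc v))) (collect-comb x n')))

  D-lift-reduce-e : ∀ v → ((+ D) ·P e n v) ≋ₙ ((+ D) ·P ι (ρ (e n v)))
  D-lift-reduce-e v = SN.≋-trans (SN.≐⇒≋ (·P-distrib-- (+ D) (X^ n v) (X^ n 0)))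
                        (SN.≋-trans (SN.≋-- (D-periodic v) (D-periodic 0))
                          (SN.≐⇒≋ (≐-trans (≐-sym (·P-distrib-- (+ D) _ _)) (·P-cong (+ D) ιρe))))
    where
      ιρe : (X^ n (v % m) -P X^ n (0 % m)) ≐ ι (ρ (e n v))
      ιρe = ≐-sym (≐-trans (ι-cong (ρ-e v)) (≐-trans (ι-- (X^ m v) (X^ m 0)) (-P-cong (ι-X v) (ι-X 0))))

  D-lift-reduce : ∀ x → ((+ D) ·P Pn x) ≋ₙ ((+ D) ·P ι (ρ (Pn x)))
  D-lift-reduce x =
    SN.≋-trans (SN.≐⇒≋ (≐-sym (comb-gscale (e n) (+ D) x n')))
      (SN.≋-trans (SN.≋-comb _ _ D-lift-reduce-e x n')
        (SN.≐⇒≋ (≐-trans (comb-gscale (λ v → ι (ρ (e n v))) (+ D) x n')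
          (·P-cong (+ D) (≐-trans (≐-sym (ι-comb (λ v → ρ (e n v)) x n')) (ι-cong (≐-sym (ρ-comb (e n) x n'))))))))

  -- The torsion projection is multiplication by c = 1 - aD = -bM.
  c : ℤ
  c = + 1 ℤ.- (+ a) ℤ.* (+ D)

  c≡-bM : c ≡ ℤ.- ((+ b) ℤ.* (+ M))
  c≡-bM = trans (cong (λ t → + 1 ℤ.- t) aD≡1+bM) (lemma (+ b) (+ M))
    where
      lemma : ∀ b M → + 1 ℤ.- (+ 1 ℤ.+ b ℤ.* M) ≡ ℤ.- (b ℤ.* M)
      lemma = solve-∀

  to : (ℕ → ℤ) → (ℕ → ℤ) × (ℕ → ℤ)
  to x = (λ v → c ℤ.* x v) , reduce x

  -- c·x is D-torsion: D·c·x = -b·(DM)·x and DM kills Z_n.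
  to-torsion : ∀ x → SN.Sp (Pn (times (Presented n (R n)) D (λ v → c ℤ.* x v)) -P Pn (λ _ → + 0))
  to-torsion x = SN.sp-ext rewrite-as (SN.sp· (ℤ.- (+ b)) DM·x)
    where
      DM·x : SN.Sp (((+ D) ℤ.* (+ M)) ·P Pn x)
      DM·x = SN.sp-ext (comb-gscale (e n) ((+ D) ℤ.* (+ M)) x n') (SN.sp-comb _ DM-kills x n')
      lemma : ∀ D b M y → (ℤ.- b) ℤ.* ((D ℤ.* M) ℤ.* y) ≡ D ℤ.* ((ℤ.- (b ℤ.* M)) ℤ.* y) ℤ.- + 0
      lemma = solve-∀
      rewrite-as : ((ℤ.- (+ b)) ·P (((+ D) ℤ.* (+ M)) ·P Pn x))
                 ≐ (Pn (times (Presented n (R n)) D (λ v → c ℤ.* x v)) -P Pn (λ _ → + 0))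
      rewrite-as i = sym (trans (cong₂ ℤ._-_ (trans (Pn-times D _ i) (cong ((+ D) ℤ.*_) (Pn-scale c x i))) (comb-zero (e n) n' i))
                       (trans (cong (λ t → (+ D) ℤ.* (t ℤ.* Pn x i) ℤ.- + 0) c≡-bM) (sym (lemma (+ D) (+ b) (+ M) (Pn x i)))))

  to-wd₁ : ∀ x y → SN.Sp (Pn x -P Pn y) → SN.Sp (Pn (λ v → c ℤ.* x v) -P Pn (λ v → c ℤ.* y v))
  to-wd₁ x y h = SN.sp-ext (≐-trans (·P-distrib-- c (Pn x) (Pn y)) (≐-sym (-P-cong (Pn-scale c x) (Pn-scale c y)))) (SN.sp· c h)

  to-wd₂ : ∀ x y → SN.Sp (Pn x -P Pn y) → SM.Sp (Pm (reduce x) -P Pm (reduce y))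
  to-wd₂ x y h = SM.sp-ext (≐-trans (ρ-- (Pn x) (Pn y)) (-P-cong (≐-sym (Pm-reduce x)) (≐-sym (Pm-reduce y)))) (reduce-span h)

  to-hom₁ : ∀ (x y : ℕ → ℤ) → SN.Sp (Pn (λ v → c ℤ.* (x v ℤ.+ y v)) -P Pn (λ v → c ℤ.* x v ℤ.+ c ℤ.* y v))
  to-hom₁ x y = SN.unw (SN.≐⇒≋ (comb-cong-c (e n) (λ v → c ℤ.* (x v ℤ.+ y v)) (λ v → c ℤ.* x v ℤ.+ c ℤ.* y v) n' (λ v _ → ℤP.*-distribˡ-+ c (x (suc v)) (y (suc v)))))

  to-hom₂ : ∀ x y → SM.Sp (Pm (reduce (λ v → x v ℤ.+ y v)) -P Pm (λ u → reduce x u ℤ.+ reduce y u))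
  to-hom₂ x y = SM.unw (SM.≐⇒≋ (comb-cong-c (e m) (reduce (λ v → x v ℤ.+ y v)) (λ u → reduce x u ℤ.+ reduce y u) m' (λ v _ → collect-+ n' x y (suc v))))

  -- Trivial kernel: p = c·p + a·(D·p), and D·p ≡ D·ι(ρ p) lies in the span when ρ p does.
  kernel-trivial : ∀ z → SN.Sp (c ·P Pn z) → SM.Sp (ρ (Pn z)) → SN.Sp (Pn z)
  kernel-trivial z hc hρ = SN.sp-ext (λ i → split (Pn z i)) (SN.sp+ hc (SN.sp· (+ a) hD))
    where
      hD : SN.Sp ((+ D) ·P Pn z)
      hD = SN.sp-resp (D-lift-reduce z) (lift-span hρ)
      split : ∀ t → c ℤ.* t ℤ.+ (+ a) ℤ.* ((+ D) ℤ.* t) ≡ t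
      split = lemma (+ a) (+ D)
        where
          lemma : ∀ A D t → (+ 1 ℤ.- A ℤ.* D) ℤ.* t ℤ.+ A ℤ.* (D ℤ.* t) ≡ t
          lemma = solve-∀

  to-inj : ∀ x y → SN.Sp (Pn (λ v → c ℤ.* x v) -P Pn (λ v → c ℤ.* y v)) → SM.Sp (Pm (reduce x) -P Pm (reduce y))
         → SN.Sp (Pn x -P Pn y)
  to-inj x y hc hρ = SN.sp-ext (Pn-diff x y) (kernel-trivial z hc′ hρ′)
    where
      z : ℕ → ℤ
      z v = x v ℤ.- y v
      hc′ : SN.Sp (c ·P Pn z)
      hc′ = SN.sp-ext (≐-trans (-P-cong (Pn-scale c x) (Pn-scale c y))
                        (≐-trans (≐-sym (·P-distrib-- c (Pn x) (Pn y))) (·P-cong c (≐-sym (Pn-diff x y))))) hc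
      hρ′ : SM.Sp (ρ (Pn z))
      hρ′ = SM.sp-ext (≐-trans (-P-cong (Pm-reduce x) (Pm-reduce y))
                        (≐-trans (≐-sym (ρ-- (Pn x) (Pn y))) (ρ-cong (≐-sym (Pn-diff x y))))) hρ

  extend : (ℕ → ℤ) → ℕ → ℤ
  extend z v with v ℕ.<? m
  ... | yes _ = z v
  ... | no _  = + 0

  extend-< : ∀ z v → v < m → extend z v ≡ z v
  extend-< z v lt with v ℕ.<? m
  ... | yes _   = refl
  ... | no v≮m = ⊥-elim (v≮m lt)

  extend-≥ : ∀ z v → m ≤ v → extend z v ≡ + 0
  extend-≥ z v ge with v ℕ.<? m
  ... | yes lt = ⊥-elim (ℕP.<⇒≱ lt ge)
  ... | no _   = refl

  Pn-extend : ∀ z → Pn (extend z) ≐ comb n (e n) z m'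
  Pn-extend z =
    ≐-trans (subst (λ j → comb n (e n) (extend z) j ≐ comb n (e n) (extend z) m') (ℕP.m+[n∸m]≡n (ℕP.≤-pred m≤n))
              (comb-trunc (e n) (extend z) m' (n' ∸ m') (λ v h → extend-≥ z (suc v) (s≤s h))))
            (comb-cong-c (e n) (extend z) z m' (λ v h → extend-< z (suc v) (s≤s h)))

  reduce-extend : ∀ z → ρ (Pn (extend z)) ≐ Pm z
  reduce-extend z = ≐-trans (ρ-cong (Pn-extend z)) (≐-trans (ρ-comb (e n) z m') (comb-cong-g _ (e m) z m' (λ v _ → ρ-e (suc v))))

  M·comb : ∀ z j → SM.Sp ((+ M) ·P comb m (e m) z j)
  M·comb z j = SM.sp-ext (comb-gscale (e m) (+ M) z j) (SM.sp-comb _ M-kills z j)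

  -- The preimage of (y , z) for D-torsion y is x = y + aD·(z extended by zero).
  module Preimage (y z : ℕ → ℤ) (D·y : SN.Sp ((+ D) ·P Pn y)) where
    C : ℤ
    C = (+ a) ℤ.* (+ D)

    x : ℕ → ℤ
    x v = y v ℤ.+ C ℤ.* extend z v

    Pn-x : Pn x ≐ (Pn y +P (C ·P Pn (extend z)))
    Pn-x = ≐-trans (comb-add (e n) y _ n') (+P-cong {p = Pn y} ≐-refl (Pn-scale C (extend z)))

    -- c·x - y = -(aD)·y + c·aD·ext z, and both terms vanish: the first since D·y does,
    -- the second since c·aD = -ab·(DM) and DM kills Z_n.
    torsion-part : SN.Sp (Pn (λ v → c ℤ.* x v) -P Pn y)
    torsion-part = SN.sp-ext (λ i → sym (trans (cong (ℤ._- Pn y i) (trans (Pn-scale c x i) (cong (c ℤ.*_) (Pn-x i))))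
                                         (expand (Pn y i) (Pn (extend z) i))))
                     (SN.sp+ (SN.sp· (ℤ.- + 1) C·y) cC·ext)
      where
        C·y : SN.Sp (C ·P Pn y)
        C·y = SN.sp-ext (λ i → sym (ℤP.*-assoc (+ a) (+ D) (Pn y i))) (SN.sp· (+ a) D·y)
        cC·ext : SN.Sp ((c ℤ.* C) ·P Pn (extend z))
        cC·ext = SN.sp-ext (λ i → trans (regroup (+ b) (+ a) (+ D) (+ M) _)
                                    (trans (cong (λ t → (ℤ.- ((+ b) ℤ.* (+ M)) ℤ.* C) ℤ.* t) (sym (Pn-extend z i)))
                                      (cong (λ t → (t ℤ.* C) ℤ.* Pn (extend z) i) (sym c≡-bM))))
                   (SN.sp· (ℤ.- ((+ b) ℤ.* (+ a))) (SN.sp-ext (comb-gscale (e n) ((+ D) ℤ.* (+ M)) z m') (SN.sp-comb _ DM-kills z m')))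
          where
            regroup : ∀ b a D M l → (ℤ.- (b ℤ.* a)) ℤ.* ((D ℤ.* M) ℤ.* l) ≡ (ℤ.- (b ℤ.* M) ℤ.* (a ℤ.* D)) ℤ.* l
            regroup = solve-∀
        expand : ∀ u l → c ℤ.* (u ℤ.+ C ℤ.* l) ℤ.- u ≡ (ℤ.- + 1) ℤ.* (C ℤ.* u) ℤ.+ (c ℤ.* C) ℤ.* l
        expand u l = lemma C u l
          where
            lemma : ∀ C u l → (+ 1 ℤ.- C) ℤ.* (u ℤ.+ C ℤ.* l) ℤ.- u ≡ (ℤ.- + 1) ℤ.* (C ℤ.* u) ℤ.+ ((+ 1 ℤ.- C) ℤ.* C) ℤ.* l
            lemma = solve-∀

    -- ρ(Pn y) = a·ρ(D·y) - b·M·ρ(Pn y) vanishes in Z_m.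
    reduce-y : SM.Sp (ρ (Pn y))
    reduce-y = SM.sp-ext (λ i → trans (cong₂ ℤ._+_ (cong ((+ a) ℤ.*_) (ρ-· (+ D) (Pn y) i))
                                                   (cong (λ t → (ℤ.- (+ b)) ℤ.* ((+ M) ℤ.* t)) (sym (Pm-y i))))
                                      (split (ρ (Pn y) i)))
                 (SM.sp+ (SM.sp· (+ a) (reduce-span D·y)) (SM.sp· (ℤ.- (+ b)) (M·comb y n')))
      where
        Pm-y : ρ (Pn y) ≐ comb m (e m) y n'
        Pm-y = ≐-trans (ρ-comb (e n) y n') (comb-cong-g _ (e m) y n' (λ v _ → ρ-e (suc v)))
        split : ∀ t → (+ a) ℤ.* ((+ D) ℤ.* t) ℤ.+ (ℤ.- (+ b)) ℤ.* ((+ M) ℤ.* t) ≡ t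
        split t = trans (lemma₁ (+ a) (+ D) (+ b) (+ M) t)
                    (trans (cong (λ s → s ℤ.* t ℤ.- (+ b) ℤ.* (+ M) ℤ.* t) aD≡1+bM) (lemma₂ (+ b) (+ M) t))
          where
            lemma₁ : ∀ a D b M t → a ℤ.* (D ℤ.* t) ℤ.+ (ℤ.- b) ℤ.* (M ℤ.* t) ≡ (a ℤ.* D) ℤ.* t ℤ.- b ℤ.* M ℤ.* t
            lemma₁ = solve-∀
            lemma₂ : ∀ b M t → (+ 1 ℤ.+ b ℤ.* M) ℤ.* t ℤ.- b ℤ.* M ℤ.* t ≡ t
            lemma₂ = solve-∀

    -- ρ(Pn x) - Pm z = ρ(Pn y) + (aD - 1)·Pm z = ρ(Pn y) + b·M·Pm z vanishes in Z_m.
    quotient-part : SM.Sp (Pm (reduce x) -P Pm z)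
    quotient-part = SM.sp-ext (λ i → sym (trans (cong (ℤ._- Pm z i) (reduce-x i))
                                          (trans (cong (λ t → ρ (Pn y) i ℤ.+ t ℤ.* Pm z i ℤ.- Pm z i) aD≡1+bM)
                                                 (lemma (ρ (Pn y) i) (Pm z i) (+ b) (+ M)))))
                      (SM.sp+ reduce-y (SM.sp· (+ b) (M·comb z m')))
      where
        reduce-x : Pm (reduce x) ≐ (ρ (Pn y) +P (C ·P Pm z))
        reduce-x = ≐-trans (Pm-reduce x)
                     (≐-trans (ρ-cong Pn-x) (≐-trans (ρ-+ (Pn y) (C ·P Pn (extend z))) (+P-cong {p = ρ (Pn y)} ≐-refl
                       (≐-trans (ρ-· C (Pn (extend z))) (·P-cong C (reduce-extend z))))))
        lemma : ∀ u q b M → u ℤ.+ (+ 1 ℤ.+ b ℤ.* M) ℤ.* q ℤ.- q ≡ u ℤ.+ b ℤ.* (M ℤ.* q)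
        lemma = solve-∀

  isomorphism : Iso (Presented n (R n)) (Kernel (Presented n (R n)) D ⊕G Presented m (R m))
  isomorphism = record
    { to   = to
    ; elem = λ x _ → (tt , to-torsion x) , tt
    ; wd   = λ x y _ _ h → to-wd₁ x y h , to-wd₂ x y h
    ; hom  = λ x y _ _ → to-hom₁ x y , to-hom₂ x y
    ; inj  = λ x y _ _ h → to-inj x y (proj₁ h) (proj₂ h)
    ; surj = λ { (y , z) ((_ , torsion) , _) → let open Preimage y z (D-torsion y torsion) in x , tt , torsion-part , quotient-part }
    }
    where
      D-torsion : ∀ y → SN.Sp (Pn (times (Presented n (R n)) D y) -P Pn (λ _ → + 0)) → SN.Sp ((+ D) ·P Pn y)
      D-torsion y = SN.sp-ext (λ i → trans (cong₂ ℤ._-_ (Pn-times D y i) (comb-zero (e n) n' i)) (ℤP.+-identityʳ _))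

·P-*-assoc : ∀ {N} a b (p : Poly N) → (+ (a ℕ.* b)) ·P p ≐ ((+ a) ·P ((+ b) ·P p))
·P-*-assoc a b p i = trans (cong (ℤ._* p i) (ℤP.pos-* a b)) (ℤP.*-assoc (+ a) (+ b) (p i))

*-mod : ∀ N .{{_ : ℕ.NonZero N}} d v → (d ℕ.* v) % N ≡ (d ℕ.* (v % N)) % N
*-mod N d v = trans (DM.%-distribˡ-* d v N)
                (trans (cong (λ t → ((d % N) ℕ.* t) % N) (sym (DM.m%n%n≡m%n v N))) (sym (DM.%-distribˡ-* d (v % N) N)))

module SpanFacts (N' : ℕ) (R : ℕ → Poly (suc N')) where
  open Span (suc N') R

  periodic-in-span : (∀ v → R v ≐ R (v % suc N')) → Sp (R 0) → ∀ v → Sp (R v)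
  periodic-in-span periodic R₀ v with v % suc N' ℕ.≟ 0
  ... | yes v≡0 = sp-ext (≐-sym (≐-trans (periodic v) (λ i → cong (λ t → R t i) v≡0))) R₀
  ... | no v≢0  = sp-ext (≐-sym (periodic v)) (sp-gen (v % suc N') (ℕP.n≢0⇒n>0 v≢0) (ℕP.≤-pred (DM.m%n<n v (suc N'))))

  e≋⇒X≋ : ∀ (K : ℤ) v w → (K ·P e (suc N') v) ≋ (K ·P e (suc N') w) → (K ·P X^ (suc N') v) ≋ (K ·P X^ (suc N') w)
  e≋⇒X≋ K v w (≋i h) = ≋i (sp-ext (λ i → lemma K (X^ (suc N') v i) (X^ (suc N') w i) (X^ (suc N') 0 i)) h)
    where
      lemma : ∀ K x y z → K ℤ.* (x ℤ.- z) ℤ.- K ℤ.* (y ℤ.- z) ≡ K ℤ.* x ℤ.- K ℤ.* y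
      lemma = solve-∀

module SigmaRelations (d N' : ℕ) where
  open Cyclic N'
  open Span N (ε N d)
  open SpanFacts N' (ε N d)

  e-cong : ∀ a b → a % N ≡ b % N → e N a ≐ e N b
  e-cong a b h = -P-cong (X-modeq a b h) ≐-refl

  ε-periodic : ∀ v → ε N d v ≐ ε N d (v % N)
  ε-periodic v = -P-cong (·P-cong (+ d) (e-cong _ _ (sym (DM.m%n%n≡m%n v N)))) (e-cong _ _ (*-mod N d v))

  ε0 : ε N d 0 ≐ 0P N
  ε0 i = trans (cong (λ y → (+ d) ℤ.* (X^ N 0 i ℤ.- X^ N 0 i) ℤ.- (y ℤ.- X^ N 0 i))
                     (X-modeq (d ℕ.* 0) 0 (cong (_% N) (ℕP.*-zeroʳ d)) i))
               (lemma (+ d) (X^ N 0 i))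
    where
      lemma : ∀ d x → d ℤ.* (x ℤ.- x) ℤ.- (x ℤ.- x) ≡ + 0
      lemma = solve-∀

  ε-in-span : ∀ v → Sp (ε N d v)
  ε-in-span = periodic-in-span ε-periodic (sp-ext (≐-sym ε0) sp0)

  d^j·e : ∀ j v → ((+ (d ^ j)) ·P e N v) ≋ e N (d ^ j ℕ.* v)
  d^j·e zero    v = ≐⇒≋ (λ i → trans (ℤP.*-identityˡ _) (e-cong v (1 ℕ.* v) (cong (_% N) (sym (ℕP.*-identityˡ v))) i))
  d^j·e (suc j) v =
    ≋-trans (≐⇒≋ (·P-*-assoc d (d ^ j) (e N v)))
      (≋-trans (≋-· (+ d) (d^j·e j v))
        (≋-trans (≋i (ε-in-span (d ^ j ℕ.* v))) (≐⇒≋ (e-cong _ _ (cong (_% N) (sym (ℕP.*-assoc d (d ^ j) v)))))))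

  power-shift : ∀ j t v → N ∣ d ^ j ℕ.* t → ((+ (d ^ j)) ·P X^ N v) ≋ ((+ (d ^ j)) ·P X^ N (v ℕ.+ t))
  power-shift j t v h = e≋⇒X≋ (+ (d ^ j)) v (v ℕ.+ t)
    (≋-trans (d^j·e j v)
      (≋-trans (≐⇒≋ (-P-cong (≐-sym (≐-trans (λ i → cong (λ z → X^ N z i) (ℕP.*-distribˡ-+ (d ^ j) v t)) (X-shift _ _ h))) ≐-refl))
        (≋-sym (d^j·e j (v ℕ.+ t)))))

  -- d^j L e_v ≡ d^j' e_v - d^j e_v ≡ e_{d^j' v} - e_{d^j v} = 0, as d^j' v ≡ d^j v (mod N).
  power-kill : ∀ j j' L v → N ∣ d ^ j ℕ.* L → d ^ j ℕ.+ d ^ j ℕ.* L ≡ d ^ j'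
             → Sp ((+ (d ^ j ℕ.* L)) ·P e N v)
  power-kill j j' L v h hj = ≋0⇒Sp (≋-trans as-difference (≋-trans (≋-- (d^j·e j' v) (d^j·e j v)) (≐⇒≋ cancels)))
    where
      K = d ^ j
      as-difference : ((+ (K ℕ.* L)) ·P e N v) ≋ (((+ (d ^ j')) ·P e N v) -P ((+ K) ·P e N v))
      as-difference = ≐⇒≋ (λ i → trans (lemma (+ K) (+ (K ℕ.* L)) (e N v i))
                        (cong (λ z → z ℤ.* e N v i ℤ.- (+ K) ℤ.* e N v i) (trans (sym (ℤP.pos-+ K (K ℕ.* L))) (cong +_ hj))))
        where
          lemma : ∀ a b x → b ℤ.* x ≡ (a ℤ.+ b) ℤ.* x ℤ.- a ℤ.* x
          lemma = solve-∀
      same-exponent : X^ N (d ^ j' ℕ.* v) ≐ X^ N (K ℕ.* v)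
      same-exponent = ≐-trans (λ i → cong (λ z → X^ N z i) (trans (cong (ℕ._* v) (sym hj)) (ℕP.*-distribʳ-+ v K (K ℕ.* L))))
                              (X-shift (K ℕ.* v) (K ℕ.* L ℕ.* v) (Div.∣-trans h (Div.m∣m*n v)))
      cancels : (e N (d ^ j' ℕ.* v) -P e N (K ℕ.* v)) ≐ 0P N
      cancels i = trans (cong (λ z → (z ℤ.- X^ N 0 i) ℤ.- e N (K ℕ.* v) i) (same-exponent i)) (ℤP.+-inverseʳ (e N (K ℕ.* v) i))

module SandpileRelations (d N' : ℕ) where
  open Cyclic N'
  open Span N (f N d)
  open SpanFacts N' (f N d)

  f-periodic : ∀ v → f N d v ≐ f N d (v % N)
  f-periodic v = -P-cong (·P-cong (+ d) (≐-sym (X-mod v))) (geo-modeq _ _ d (*-mod N d v))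

  f-sum : ℕ → Poly N
  f-sum zero    = 0P N
  f-sum (suc J) = f-sum J +P f N d J

  f-sum-closed : ∀ J → f-sum J ≐ (((+ d) ·P geo N 0 J) -P geo N 0 (d ℕ.* J))
  f-sum-closed zero i = sym (trans (cong (λ z → (+ d) ℤ.* + 0 ℤ.- geo N 0 z i) (ℕP.*-zeroʳ d)) (cong (ℤ._+ + 0) (ℤP.*-zeroʳ (+ d))))
  f-sum-closed (suc J) i =
    trans (cong (ℤ._+ f N d J i) (f-sum-closed J i))
      (trans (lemma (+ d) (geo N 0 J i) (geo N 0 (d ℕ.* J) i) (X^ N J i) (geo N (d ℕ.* J) d i))
        (cong (λ t → (+ d) ℤ.* geo N 0 (suc J) i ℤ.- t) (sym next-block)))
    where
      lemma : ∀ d G H x F → (d ℤ.* G ℤ.- H) ℤ.+ (d ℤ.* x ℤ.- F) ≡ d ℤ.* (G ℤ.+ x) ℤ.- (H ℤ.+ F)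
      lemma = solve-∀
      next-block : geo N 0 (d ℕ.* suc J) i ≡ geo N 0 (d ℕ.* J) i ℤ.+ geo N (d ℕ.* J) d i
      next-block = trans (cong (λ z → geo N 0 z i) (trans (ℕP.*-suc d J) (ℕP.+-comm d (d ℕ.* J)))) (geo-split 0 (d ℕ.* J) d i)

  -- f_0 + … + f_{N-1} = 0, so f_0 is minus the sum of the generators.
  f-sum-full : f-sum N ≐ 0P N
  f-sum-full i = trans (f-sum-closed N i)
                   (trans (cong (λ t → (+ d) ℤ.* geo N 0 N i ℤ.- t) (geo-mult 0 d i)) (ℤP.+-inverseʳ ((+ d) ℤ.* geo N 0 N i)))

  f-sum-comb : ∀ J → f-sum (suc J) ≐ (f N d 0 +P comb N (f N d) (λ _ → + 1) J)
  f-sum-comb zero    i = trans (ℤP.+-identityˡ (f N d 0 i)) (sym (ℤP.+-identityʳ (f N d 0 i)))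
  f-sum-comb (suc J) i =
    trans (cong (ℤ._+ f N d (suc J) i) (f-sum-comb J i)) (lemma (f N d 0 i) (comb N (f N d) (λ _ → + 1) J i) (f N d (suc J) i))
    where
      lemma : ∀ a b c → (a ℤ.+ b) ℤ.+ c ≡ a ℤ.+ (b ℤ.+ + 1 ℤ.* c)
      lemma = solve-∀

  f0-in-span : Sp (f N d 0)
  f0-in-span = sp-ext (λ i → sym (f0≡ i)) (sp· (ℤ.- + 1) ((λ _ → + 1) , (λ i → refl)))
    where
      f0≡ : ∀ i → f N d 0 i ≡ (ℤ.- + 1) ℤ.* comb N (f N d) (λ _ → + 1) N' i
      f0≡ i = trans (lemma₁ (f N d 0 i) (comb N (f N d) (λ _ → + 1) N' i))
               (trans (cong (ℤ._- comb N (f N d) (λ _ → + 1) N' i) (trans (sym (f-sum-comb N' i)) (f-sum-full i)))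
                 (lemma₂ (comb N (f N d) (λ _ → + 1) N' i)))
        where
          lemma₁ : ∀ a b → a ≡ (a ℤ.+ b) ℤ.- b
          lemma₁ = solve-∀
          lemma₂ : ∀ b → + 0 ℤ.- b ≡ (ℤ.- + 1) ℤ.* b
          lemma₂ = solve-∀

  f-in-span : ∀ v → Sp (f N d v)
  f-in-span = periodic-in-span f-periodic f0-in-span

  d·geo : ∀ a K → ((+ d) ·P geo N a K) ≋ geo N (d ℕ.* a) (d ℕ.* K)
  d·geo a zero    = ≐⇒≋ (λ i → trans (ℤP.*-zeroʳ (+ d)) (cong (λ z → geo N (d ℕ.* a) z i) (sym (ℕP.*-zeroʳ d))))
  d·geo a (suc K) =
    ≋-trans (≐⇒≋ (λ i → ℤP.*-distribˡ-+ (+ d) (geo N a K i) (X^ N (a ℕ.+ K) i)))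
      (≋-trans (≋-+ (d·geo a K) (≋i (f-in-span (a ℕ.+ K)))) (≐⇒≋ joined))
    where
      joined : (geo N (d ℕ.* a) (d ℕ.* K) +P geo N (d ℕ.* (a ℕ.+ K)) d) ≐ geo N (d ℕ.* a) (d ℕ.* suc K)
      joined i = sym (trans (cong (λ z → geo N (d ℕ.* a) z i) (trans (ℕP.*-suc d K) (ℕP.+-comm d (d ℕ.* K))))
                   (trans (geo-split (d ℕ.* a) (d ℕ.* K) d i)
                     (cong (λ z → geo N (d ℕ.* a) (d ℕ.* K) i ℤ.+ geo N z d i) (sym (ℕP.*-distribˡ-+ d a K)))))

  d^j·X : ∀ j v → ((+ (d ^ j)) ·P X^ N v) ≋ geo N (d ^ j ℕ.* v) (d ^ j)
  d^j·X zero    v = ≐⇒≋ (λ i → trans (ℤP.*-identityˡ _)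
                      (sym (trans (ℤP.+-identityˡ _) (X-modeq _ _ (cong (_% N) (trans (ℕP.+-identityʳ (1 ℕ.* v)) (ℕP.*-identityˡ v))) i))))
  d^j·X (suc j) v =
    ≋-trans (≐⇒≋ (·P-*-assoc d (d ^ j) (X^ N v)))
      (≋-trans (≋-· (+ d) (d^j·X j v))
        (≋-trans (d·geo (d ^ j ℕ.* v) (d ^ j))
          (≐⇒≋ (λ i → cong (λ z → geo N z (d ℕ.* d ^ j) i) (sym (ℕP.*-assoc d (d ^ j) v))))))

  power-shift : ∀ j t v → N ∣ d ^ j ℕ.* t → ((+ (d ^ j)) ·P X^ N v) ≋ ((+ (d ^ j)) ·P X^ N (v ℕ.+ t))
  power-shift j t v h =
    ≋-trans (d^j·X j v) (≋-trans (≐⇒≋ (geo-modeq _ _ (d ^ j) same-start)) (≋-sym (d^j·X j (v ℕ.+ t))))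
    where
      same-start : (d ^ j ℕ.* v) % N ≡ (d ^ j ℕ.* (v ℕ.+ t)) % N
      same-start = sym (trans (cong (_% N) (ℕP.*-distribˡ-+ (d ^ j) v t)) (DM.%-remove-+ʳ (d ^ j ℕ.* v) h))

  -- d^j L x^w ≡ (block of length d^j') - (block of length d^j) = block of length d^j L,
  -- which is independent of w since N ∣ d^j L; hence d^j L kills e_w = x^w - 1.
  power-kill : ∀ j j' L v → N ∣ d ^ j ℕ.* L → d ^ j ℕ.+ d ^ j ℕ.* L ≡ d ^ j'
             → Sp ((+ (d ^ j ℕ.* L)) ·P e N v)
  power-kill j j' L v h hj =
    ≋0⇒Sp (≋-trans (≐⇒≋ (·P-distrib-- (+ (K ℕ.* L)) (X^ N v) (X^ N 0)))
                   (≋-trans (≋-- (KL·X v) (KL·X 0)) (≐⇒≋ (λ i → ℤP.+-inverseʳ (full i)))))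
    where
      K = d ^ j
      full = geo N 0 (K ℕ.* L)
      KL·X : ∀ w → ((+ (K ℕ.* L)) ·P X^ N w) ≋ full
      KL·X w = ≋-trans (≐⇒≋ as-difference) (≋-trans (≋-- (d^j·X j' w) (d^j·X j w)) (≐⇒≋ tail-block))
        where
          as-difference : ((+ (K ℕ.* L)) ·P X^ N w) ≐ (((+ (d ^ j')) ·P X^ N w) -P ((+ K) ·P X^ N w))
          as-difference i = trans (lemma (+ K) (+ (K ℕ.* L)) (X^ N w i))
                              (cong (λ z → z ℤ.* X^ N w i ℤ.- (+ K) ℤ.* X^ N w i) (trans (sym (ℤP.pos-+ K (K ℕ.* L))) (cong +_ hj)))
            where
              lemma : ∀ a b x → b ℤ.* x ≡ (a ℤ.+ b) ℤ.* x ℤ.- a ℤ.* x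
              lemma = solve-∀
          same-start : (d ^ j' ℕ.* w) % N ≡ (K ℕ.* w) % N
          same-start = trans (cong (λ z → (z ℕ.* w) % N) (sym hj))
                         (trans (cong (_% N) (ℕP.*-distribʳ-+ w K (K ℕ.* L)))
                           (DM.%-remove-+ʳ (K ℕ.* w) (Div.∣-trans h (Div.m∣m*n w))))
          tail-block : (geo N (d ^ j' ℕ.* w) (d ^ j') -P geo N (K ℕ.* w) K) ≐ full
          tail-block i = trans (cong (ℤ._- geo N (K ℕ.* w) K i)
                                 (trans (cong (λ z → geo N (d ^ j' ℕ.* w) z i) (sym hj))
                                   (trans (geo-split (d ^ j' ℕ.* w) K (K ℕ.* L) i)
                                     (cong₂ ℤ._+_ (geo-modeq _ _ K same-start i) (geo-dvd _ 0 (K ℕ.* L) h i)))))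
                           (lemma (geo N (K ℕ.* w) K i) (full i))
            where
              lemma : ∀ g z → (g ℤ.+ z) ℤ.- g ≡ z
              lemma = solve-∀

module RelationsUnderReduction (n' m' : ℕ) (m∣n : suc m' ∣ suc n') (d : ℕ) where
  open ReduceLift n' m' m∣n

  ρ-ε : ∀ v → ρ (ε n d v) ≐ ε m d v
  ρ-ε v = ≐-trans (ρ-- ((+ d) ·P e n v) (e n (d ℕ.* v)))
            (-P-cong (≐-trans (ρ-· (+ d) (e n v)) (·P-cong (+ d) (ρ-e v))) (ρ-e (d ℕ.* v)))

  ρ-geo : ∀ a K → ρ (geo n a K) ≐ geo m a K
  ρ-geo a zero    = ρ-0
  ρ-geo a (suc K) = ≐-trans (ρ-+ (geo n a K) (X^ n (a ℕ.+ K))) (+P-cong (ρ-geo a K) (ρ-X (a ℕ.+ K)))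

  ρ-f : ∀ v → ρ (f n d v) ≐ f m d v
  ρ-f v = ≐-trans (ρ-- ((+ d) ·P X^ n v) (geo n (d ℕ.* v) d))
            (-P-cong (≐-trans (ρ-· (+ d) (X^ n v)) (·P-cong (+ d) (ρ-X v))) (ρ-geo (d ℕ.* v) d))

  -- ε and f are ℤ-linear in monomials, so D·ι commutes with them once it does with monomials.
  module Lift (D : ℕ) (R : ℕ → Poly n)
              (D-lift-X : ∀ w → Span._≋_ n R ((+ D) ·P ι (X^ m w)) ((+ D) ·P X^ n w)) where
    open Span n R

    D-lift-e : ∀ v → ((+ D) ·P ι (e m v)) ≋ ((+ D) ·P e n v)
    D-lift-e v = ≋-trans (≐⇒≋ (≐-trans (·P-cong (+ D) (ι-- (X^ m v) (X^ m 0))) (·P-distrib-- (+ D) _ _)))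
                   (≋-trans (≋-- (D-lift-X v) (D-lift-X 0)) (≐⇒≋ (≐-sym (·P-distrib-- (+ D) _ _))))

    D-lift-ε : ∀ v → ((+ D) ·P ι (ε m d v)) ≋ ((+ D) ·P ε n d v)
    D-lift-ε v = ≋-trans (≐⇒≋ expand) (≋-trans (≋-- (≋-· (+ d) (D-lift-e v)) (D-lift-e (d ℕ.* v))) (≐⇒≋ (≐-sym expand′)))
      where
        lemma : ∀ D d p q → D ℤ.* (d ℤ.* p ℤ.- q) ≡ d ℤ.* (D ℤ.* p) ℤ.- D ℤ.* q
        lemma = solve-∀
        expand : ((+ D) ·P ι (ε m d v)) ≐ (((+ d) ·P ((+ D) ·P ι (e m v))) -P ((+ D) ·P ι (e m (d ℕ.* v))))
        expand i = trans (cong ((+ D) ℤ.*_) (trans (ι-- ((+ d) ·P e m v) (e m (d ℕ.* v)) i)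
                                              (cong (ℤ._- ι (e m (d ℕ.* v)) i) (ι-· (+ d) (e m v) i))))
                         (lemma (+ D) (+ d) _ _)
        expand′ : ((+ D) ·P ε n d v) ≐ (((+ d) ·P ((+ D) ·P e n v)) -P ((+ D) ·P e n (d ℕ.* v)))
        expand′ i = lemma (+ D) (+ d) _ _

    D-lift-geo : ∀ a K → ((+ D) ·P ι (geo m a K)) ≋ ((+ D) ·P geo n a K)
    D-lift-geo a zero    = ≐⇒≋ (·P-cong (+ D) ι-0)
    D-lift-geo a (suc K) =
      ≋-trans (≐⇒≋ (λ i → trans (cong ((+ D) ℤ.*_) (ι-+ (geo m a K) (X^ m (a ℕ.+ K)) i)) (ℤP.*-distribˡ-+ (+ D) _ _)))
        (≋-trans (≋-+ (D-lift-geo a K) (D-lift-X (a ℕ.+ K)))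
          (≐⇒≋ (λ i → sym (ℤP.*-distribˡ-+ (+ D) (geo n a K i) (X^ n (a ℕ.+ K) i)))))

    D-lift-f : ∀ v → ((+ D) ·P ι (f m d v)) ≋ ((+ D) ·P f n d v)
    D-lift-f v = ≋-trans (≐⇒≋ expand) (≋-trans (≋-- (≋-· (+ d) (D-lift-X v)) (D-lift-geo (d ℕ.* v) d)) (≐⇒≋ (≐-sym expand′)))
      where
        lemma : ∀ D d p g → D ℤ.* (d ℤ.* p ℤ.- g) ≡ d ℤ.* (D ℤ.* p) ℤ.- D ℤ.* g
        lemma = solve-∀
        expand : ((+ D) ·P ι (f m d v)) ≐ (((+ d) ·P ((+ D) ·P ι (X^ m v))) -P ((+ D) ·P ι (geo m (d ℕ.* v) d)))
        expand i = trans (cong ((+ D) ℤ.*_) (trans (ι-- ((+ d) ·P X^ m v) (geo m (d ℕ.* v) d) i)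
                                              (cong (ℤ._- ι (geo m (d ℕ.* v) d) i) (ι-· (+ d) (X^ m v) i))))
                         (lemma (+ D) (+ d) _ _)
        expand′ : ((+ D) ·P f n d v) ≐ (((+ d) ·P ((+ D) ·P X^ n v)) -P ((+ D) ·P geo n (d ℕ.* v) d))
        expand′ i = lemma (+ D) (+ d) _ _

sigmaFamily : (d : ℕ) → RelationFamily d
sigmaFamily d = record
  { R           = λ N → ε N d
  ; rel-in-span = λ N' → SigmaRelations.ε-in-span d N'
  ; power-shift = λ N' → SigmaRelations.power-shift d N'
  ; power-kill  = λ N' → SigmaRelations.power-kill d N'
  ; reduce-rel  = λ n' m' m∣n → RelationsUnderReduction.ρ-ε n' m' m∣n d
  ; lift-rel    = λ n' m' m∣n D → RelationsUnderReduction.Lift.D-lift-ε n' m' m∣n d D (ε (suc n') d)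
  }

sandpileFamily : (d : ℕ) → RelationFamily d
sandpileFamily d = record
  { R           = λ N → f N d
  ; rel-in-span = λ N' → SandpileRelations.f-in-span d N'
  ; power-shift = λ N' → SandpileRelations.power-shift d N'
  ; power-kill  = λ N' → SandpileRelations.power-kill d N'
  ; reduce-rel  = λ n' m' m∣n → RelationsUnderReduction.ρ-f n' m' m∣n d
  ; lift-rel    = λ n' m' m∣n D → RelationsUnderReduction.Lift.D-lift-f n' m' m∣n d D (f (suc n') d)
  }

module DSequence (N d' : ℕ) where
  d : ℕ
  d = suc d'

  dSeq-pos : ∀ i → 1 ≤ dSeq N d i
  dSeq-pos i = ℕP.n≢0⇒n>0 (λ gcd≡0 → ℕP.1+n≢0 (gcd[m,n]≡0⇒n≡0 (nSeq N d i) gcd≡0))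

  div′-exact : ∀ x y → 1 ≤ y → y ∣ x → y ℕ.* div′ x y ≡ x
  div′-exact x (suc y) _ h = DM.m*[n/m]≡n h

  prod-nSeq : ∀ i → dProd N d i ℕ.* nSeq N d i ≡ N
  prod-nSeq zero    = ℕP.+-identityʳ N
  prod-nSeq (suc i) =
    trans (ℕP.*-assoc (dProd N d i) (dSeq N d i) (nSeq N d (suc i)))
      (trans (cong (dProd N d i ℕ.*_) (div′-exact (nSeq N d i) (dSeq N d i) (dSeq-pos i) (gcd[m,n]∣m (nSeq N d i) d)))
        (prod-nSeq i))

  dProd∣d^ : ∀ i → dProd N d i ∣ d ^ i
  dProd∣d^ zero    = Div.∣-refl
  dProd∣d^ (suc i) = subst (dProd N d (suc i) ∣_) (ℕP.*-comm (d ^ i) d)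
                       (Div.*-pres-∣ (dProd∣d^ i) (gcd[m,n]∣n (nSeq N d i) d))

split-family : ∀ {n' d'} (F : RelationFamily (suc d')) k δ m → δ ℕ.* m ≡ suc n' → δ ∣ suc d' ^ k → gcd m (suc d') ≡ 1
             → let open RelationFamily F in
               Iso (Presented (suc n') (R (suc n'))) (Kernel (Presented (suc n') (R (suc n'))) (suc d' ^ k) ⊕G Presented m (R m))
split-family {n'} F k δ zero δm≡n _ _ = ⊥-elim (ℕP.0≢1+n (trans (sym (ℕP.*-zeroʳ δ)) δm≡n))
split-family {n'} {d'} F k δ (suc m') δm≡n δ∣D gcd≡1 with order m' (suc d') (gcd≡1⇒coprime gcd≡1)
... | o , m∣M = Splitting.isomorphism F n' m' k o δ δm≡n δ∣D m∣M

lemma4p6 : (n d k : ℕ) → 1 ≤ n → 2 ≤ d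
    → dSeq n d k ≡ 1 → (∀ i → i < k → dSeq n d i ≢ 1)
    → Iso (SigmaG n d) (Kernel (SigmaG n d) (d ^ k) ⊕G SigmaG (nSeq n d k) d)
    × Iso (SandG n d) (Kernel (SandG n d) (d ^ k) ⊕G SandG (nSeq n d k) d)
lemma4p6 (suc n') (suc d') k (s≤s z≤n) (s≤s (s≤s z≤n)) d_k≡1 _ =
  split-family (sigmaFamily d) k δ m δm≡n δ∣d^k d_k≡1 , split-family (sandpileFamily d) k δ m δm≡n δ∣d^k d_k≡1
  where
    open DSequence (suc n') d'
    δ m : ℕ
    δ = dProd (suc n') d k
    m = nSeq (suc n') d k
    δm≡n : δ ℕ.* m ≡ suc n'
    δm≡n = prod-nSeq k
    δ∣d^k : δ ∣ d ^ k
    δ∣d^k = dProd∣d^ k
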